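{- For a positive integer $n$, let $h_{\mathcal{D},\mathcal{E}}(n)$ (resp. $h_{\mathcal{D},\mathcal{O}}(n)$) be the number of partitions $\pi$ into distinct parts with $\Gamma(\pi)=n$ and an even (resp. odd) number of parts. Then for all $n\ge1$, $$h_{\mathcal{D},\mathcal{E}}(n)=\sum_{k\ge0}\binom{n-2k-2}{2k+1},\qquad h_{\mathcal{D},\mathcal{O}}(n)=\sum_{k\ge0}\binom{n-2k-1}{2k}.$$
   Context: For a non-empty partition $\pi=(\pi_1\ge\cdots\ge\pi_r\ge1)$, $\ell(\pi)=r$ and $\Gamma(\pi)=\pi_1+\ell(\pi)-1$ (length of the largest hook). Here $\binom{a}{b}$ is taken to be $0$ unless $0\le b\le a$. -}

module Defs where

open import Data.Nat using (ℕ; zero; suc; _+_; _*_; _∸_; _<_; _>_)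
open import Data.Nat.Combinatorics using (_C_)
open import Data.Integer using (ℤ; +_; -[1+_]; _-_)
open import Data.List using (List; []; _∷_; length; map; upTo)
open import Data.Nat.ListAction using (sum)
open import Data.List.Relation.Unary.All using (All)
open import Data.List.Relation.Unary.Linked using (Linked)
open import Data.Nat.DivMod using (_%_)
open import Relation.Binary.PropositionalEquality using (_≡_)

-- Binomial coefficient with integer top: binom a b = (a choose b) if 0 ≤ b ≤ a, else 0.
binom : ℤ → ℕ → ℕ
binom (+ a)    b = a C b
binom -[1+ _ ] b = 0

-- A partition into distinct parts: a non-empty, strictly decreasing list of positive integers.
record DistinctPartition : Set where
  constructor mkDP
  field
    largest  : ℕ
    rest     : List ℕ
    strict   : Linked _>_ (largest ∷ rest)
    positive : All (0 <_) (largest ∷ rest)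

open DistinctPartition public

parts : DistinctPartition → List ℕ
parts π = largest π ∷ rest π

len : DistinctPartition → ℕ
len π = length (parts π)

Γ : DistinctPartition → ℕ
Γ π = largest π + len π ∸ 1

-- Σ_{k=0}^{n} f k  (the sums in the statement have only finitely many nonzero terms, all with k ≤ n)
sumTo : ℕ → (ℕ → ℕ) → ℕ
sumTo n f = sum (map f (upTo (suc n)))

hDE-formula : ℕ → ℕ
hDE-formula n = sumTo n (λ k → binom ((+ n) - (+ (2 * k + 2))) (2 * k + 1))

hDO-formula : ℕ → ℕ
hDO-formula n = sumTo n (λ k → binom ((+ n) - (+ (2 * k + 1))) (2 * k))

Even : ℕ → Set
Even m = m % 2 ≡ 0

Odd : ℕ → Set
Odd m = m % 2 ≡ 1

module Submission where

-- A distinct partition π with largest part L and j further parts is the same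
-- thing as a strictly decreasing chain L > x₁ > ⋯ > xⱼ > 0, and Γ(π) = L + j.
-- Hence the partitions with Γ(π) = n and exactly j + 1 parts are the chains
-- of length j below n − j, and there are  binom(n − j − 1, j)  of them
-- (choose the j parts among 1, …, n − j − 1).  Summing over the tail lengths
-- j = 2k + 1 (an even number of parts) or j = 2k (an odd number of parts)
-- gives the two formulas.

open import Defs
open import Data.Nat using (ℕ; _≥_)
open import Data.Fin using (Fin)
open import Data.Product using (Σ; _×_)
open import Relation.Binary.PropositionalEquality using (_≡_)
open import Function.Bundles using (_↔_)

open import Data.Nat using (zero; suc; _+_; _*_; _∸_; _<_; _>_; _≤_; z≤n; s≤s; _≟_; ⌊_/2⌋; s≤s⁻¹)
open import Data.Nat.Properties
open import Data.Nat.Combinatorics using (_C_; nCk+nC[k+1]≡[n+1]C[k+1])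
open import Data.Integer using (+_; _-_)
open import Data.Integer.Properties using ([1+m]⊖[1+n]≡m⊖n)
open import Data.Fin as F using (toℕ; fromℕ<)
open import Data.Fin.Properties using (toℕ-fromℕ<; toℕ-injective; +↔⊎)
open import Data.List using (List; []; _∷_; length; upTo; applyUpTo)
open import Data.List.Properties using (map-cong; map-applyUpTo)
open import Data.Nat.ListAction using (sum)
open import Data.List.Relation.Unary.All as All using (All; _∷_)
open import Data.List.Relation.Unary.Linked as Linked using (Linked; [-]; _∷_)
open import Data.Product using (_,_; proj₁)
open import Data.Product.Function.Dependent.Propositional using (Σ-↔)
open import Data.Sum using (_⊎_; inj₁; inj₂)
open import Data.Sum.Function.Propositional using (_⊎-cong_)
open import Data.Empty using (⊥-elim)
open import Relation.Nullary using (¬_; yes; no)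
open import Relation.Binary.PropositionalEquality
  using (refl; sym; trans; cong; cong₂; subst; module ≡-Reasoning)
open import Function.Bundles using (mk↔ₛ′)
open import Function.Properties.Inverse using (↔-refl; ↔-sym; ↔-trans)

empty↔ : {A : Set} → ¬ A → A ↔ Fin 0
empty↔ ¬a = mk↔ₛ′ (λ a → ⊥-elim (¬a a)) (λ ()) (λ ()) (λ a → ⊥-elim (¬a a))

↔Fin-cast : {A : Set} {a b : ℕ} → a ≡ b → A ↔ Fin a → A ↔ Fin b
↔Fin-cast {A} eq e = subst (λ c → A ↔ Fin c) eq e

Σ-≡-irrelevant : {A : Set} {B : A → Set} → (∀ {a} (b b′ : B a) → b ≡ b′) →
                 {a a′ : A} {b : B a} {b′ : B a′} → a ≡ a′ → (a , b) ≡ (a′ , b′)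
Σ-≡-irrelevant irr {b = b} {b′} refl = cong (_ ,_) (irr b b′)

Σ-Fin-suc : (N : ℕ) (B : Fin (suc N) → Set) →
            Σ (Fin (suc N)) B ↔ (B F.zero ⊎ Σ (Fin N) (λ k → B (F.suc k)))
Σ-Fin-suc N B = mk↔ₛ′ to from to∘from from∘to
  where
  to : Σ (Fin (suc N)) B → B F.zero ⊎ Σ (Fin N) (λ k → B (F.suc k))
  to (F.zero , b)  = inj₁ b
  to (F.suc k , b) = inj₂ (k , b)
  from : B F.zero ⊎ Σ (Fin N) (λ k → B (F.suc k)) → Σ (Fin (suc N)) B
  from (inj₁ b)       = F.zero , b
  from (inj₂ (k , b)) = F.suc k , b
  to∘from : ∀ y → to (from y) ≡ y
  to∘from (inj₁ _) = refl
  to∘from (inj₂ _) = refl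
  from∘to : ∀ x → from (to x) ≡ x
  from∘to (F.zero , _)  = refl
  from∘to (F.suc _ , _) = refl

Σ-Fin-sum : (N : ℕ) (g : ℕ → ℕ) →
            Σ (Fin N) (λ k → Fin (g (toℕ k))) ↔ Fin (sum (applyUpTo g N))
Σ-Fin-sum zero    g = empty↔ λ { (() , _) }
Σ-Fin-sum (suc N) g =
  ↔-trans (Σ-Fin-suc N (λ k → Fin (g (toℕ k))))
  (↔-trans (↔-refl ⊎-cong Σ-Fin-sum N (λ k → g (suc k)))
  (↔-sym (+↔⊎ {g 0})))

IsChain : ℕ → ℕ → List ℕ → Set
IsChain L j xs = Linked _>_ (L ∷ xs) × All (0 <_) (L ∷ xs) × length xs ≡ j

Chain : ℕ → ℕ → Set
Chain L j = Σ (List ℕ) (IsChain L j)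

IsChain-irrelevant : ∀ {L j xs} (p q : IsChain L j xs) → p ≡ q
IsChain-irrelevant (lk , al , le) (lk′ , al′ , le′) =
  cong₂ _,_ (Linked.irrelevant <-irrelevant lk lk′)
            (cong₂ _,_ (All.irrelevant <-irrelevant al al′) (≡-irrelevant le le′))

chain-≡ : ∀ {L j} {c d : Chain L j} → proj₁ c ≡ proj₁ d → c ≡ d
chain-≡ = Σ-≡-irrelevant IsChain-irrelevant

castIsChain : ∀ {L L′ j j′ xs} → L ≡ L′ → j ≡ j′ → IsChain L j xs → IsChain L′ j′ xs
castIsChain refl refl c = c

chainCount : ℕ → ℕ → ℕ
chainCount zero    j = 0
chainCount (suc m) j = m C j

no-chain-below-0 : ∀ {j} → ¬ Chain 0 j
no-chain-below-0 (_ , _ , (() ∷ _) , _)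

no-long-chain-below-1 : ∀ {j} → ¬ Chain 1 (suc j)
no-long-chain-below-1 ([] , _ , _ , ())
no-long-chain-below-1 ((_ ∷ _) , (s≤s () ∷ _) , (_ ∷ s≤s _ ∷ _) , _)

empty-chain↔ : ∀ m → Chain (suc m) 0 ↔ Fin 1
empty-chain↔ m = mk↔ₛ′ (λ _ → F.zero) (λ _ → [] , [-] , (s≤s z≤n ∷ All.[]) , refl)
  (λ { F.zero → refl ; (F.suc ()) })
  (λ { ([] , _ , _ , refl) → chain-≡ refl })

-- Pascal's rule as a bijection: a chain below m + 2 of length j + 1 either
-- starts with m + 1 (remove it) or lies entirely below m + 1.
module Pascal (m j : ℕ) where

  split : Chain (suc (suc m)) (suc j) → Chain (suc m) j ⊎ Chain (suc m) (suc j)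
  split ((x ∷ ys) , (x<L ∷ lk) , (_ ∷ 0<x ∷ al) , le) with x ≟ suc m
  ... | yes refl = inj₁ (ys , lk , (0<x ∷ al) , suc-injective le)
  ... | no x≢L′  = inj₂ ((x ∷ ys) , (≤∧≢⇒< (s≤s⁻¹ x<L) x≢L′ ∷ lk) , (s≤s z≤n ∷ 0<x ∷ al) , le)

  join : Chain (suc m) j ⊎ Chain (suc m) (suc j) → Chain (suc (suc m)) (suc j)
  join (inj₁ (ys , lk , al , le)) =
    (suc m ∷ ys) , (n<1+n (suc m) ∷ lk) , (s≤s z≤n ∷ al) , cong suc le
  join (inj₂ ((x ∷ ys) , (x<L ∷ lk) , (_ ∷ al) , le)) =
    (x ∷ ys) , (m<n⇒m<1+n x<L ∷ lk) , (s≤s z≤n ∷ al) , le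

  split∘join : ∀ y → split (join y) ≡ y
  split∘join (inj₁ (_ , _ , (_ ∷ _) , _)) with suc m ≟ suc m
  ... | yes refl = cong inj₁ (chain-≡ refl)
  ... | no L′≢L′ = ⊥-elim (L′≢L′ refl)
  split∘join (inj₂ ((x ∷ _) , (x<L′ ∷ _) , (_ ∷ _ ∷ _) , _)) with x ≟ suc m
  ... | yes refl = ⊥-elim (n≮n _ x<L′)
  ... | no _     = cong inj₂ (chain-≡ refl)

  join∘split : ∀ x → join (split x) ≡ x
  join∘split ((x ∷ _) , (_ ∷ _) , (_ ∷ _ ∷ _) , _) with x ≟ suc m
  ... | yes refl = chain-≡ refl
  ... | no _     = chain-≡ refl

  pascal↔ : Chain (suc (suc m)) (suc j) ↔ (Chain (suc m) j ⊎ Chain (suc m) (suc j))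
  pascal↔ = mk↔ₛ′ split join split∘join join∘split

chain↔ : ∀ L j → Chain L j ↔ Fin (chainCount L j)
chain↔ zero                j       = empty↔ no-chain-below-0
chain↔ (suc zero)          zero    = empty-chain↔ 0
chain↔ (suc zero)          (suc j) = empty↔ no-long-chain-below-1
chain↔ (suc (suc m))       zero    = empty-chain↔ (suc m)
chain↔ (suc (suc m))       (suc j) =
  ↔-trans (Pascal.pascal↔ m j)
  (↔-trans (chain↔ (suc m) j ⊎-cong chain↔ (suc m) (suc j))
  (↔Fin-cast (nCk+nC[k+1]≡[n+1]C[k+1] m j) (↔-sym (+↔⊎ {m C j}))))

-- The binomial of the statement, binom(n − a − 1, j), counts the chains of
-- length j below n − a (both vanish when n ≤ a).
binom≡chainCount : ∀ n a j → binom (+ n - + suc a) j ≡ chainCount (n ∸ a) j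
binom≡chainCount zero    zero    j = refl
binom≡chainCount zero    (suc a) j = refl
binom≡chainCount (suc n) zero    j = refl
binom≡chainCount (suc n) (suc a) j =
  trans (cong (λ z → binom z j) ([1+m]⊖[1+n]≡m⊖n n (suc a))) (binom≡chainCount n a j)

Γ≡largest+tail : ∀ π → Γ π ≡ largest π + length (rest π)
Γ≡largest+tail π = cong (_∸ 1) (+-suc (largest π) (length (rest π)))

tail≤Γ : ∀ π → length (rest π) ≤ Γ π
tail≤Γ π = subst (length (rest π) ≤_) (sym (Γ≡largest+tail π)) (m≤n+m _ (largest π))

partition-≡ : ∀ {π π′} → largest π ≡ largest π′ → rest π ≡ rest π′ → π ≡ π′
partition-≡ {mkDP L xs lk al} {mkDP .L .xs lk′ al′} refl refl =
  cong₂ (mkDP L xs) (Linked.irrelevant <-irrelevant lk lk′) (All.irrelevant <-irrelevant al al′)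

-- Dropping the largest part identifies the partitions with Γ = n and j + 1
-- parts with the chains of length j below n − j.
module Tail (n j : ℕ) where

  Fiber : Set
  Fiber = Σ DistinctPartition (λ π → Γ π ≡ n × length (rest π) ≡ j)

  largest≡ : ∀ π → Γ π ≡ n → length (rest π) ≡ j → largest π ≡ n ∸ j
  largest≡ π eΓ le = begin
    largest π                  ≡⟨ sym (m+n∸n≡m (largest π) t) ⟩
    largest π + t ∸ t          ≡⟨ cong (_∸ t) (sym (Γ≡largest+tail π)) ⟩
    Γ π ∸ t                    ≡⟨ cong₂ _∸_ eΓ le ⟩
    n ∸ j                      ∎
    where
    open ≡-Reasoning
    t : ℕ
    t = length (rest π)

  -- A chain below n − j is nonempty only when j < n, so that (n − j) + j = n.
  Γ-of-chain : ∀ {xs : List ℕ} → 0 < n ∸ j → length xs ≡ j → n ∸ j + suc (length xs) ∸ 1 ≡ n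
  Γ-of-chain pos le =
    trans (cong (λ t → n ∸ j + suc t ∸ 1) le)
    (trans (cong (_∸ 1) (+-suc (n ∸ j) j)) (m∸n+n≡m j≤n))
    where
    j≤n : j ≤ n
    j≤n = <⇒≤ (m∸n≢0⇒n<m (n>0⇒n≢0 pos))

  to : Fiber → Chain (n ∸ j) j
  to (π@(mkDP _ xs lk al) , eΓ , le) = xs , castIsChain (largest≡ π eΓ le) le (lk , al , refl)

  from : Chain (n ∸ j) j → Fiber
  from (xs , lk , al , le) = mkDP (n ∸ j) xs lk al , Γ-of-chain {xs} (All.head al) le , le

  from∘to : ∀ x → from (to x) ≡ x
  from∘to (π , eΓ , le) =
    Σ-≡-irrelevant (λ _ _ → cong₂ _,_ (≡-irrelevant _ _) (≡-irrelevant _ _))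
                   (partition-≡ (sym (largest≡ π eΓ le)) refl)

  tail↔ : Fiber ↔ Chain (n ∸ j) j
  tail↔ = mk↔ₛ′ to from (λ _ → chain-≡ refl) from∘to

record Enumeration (P : ℕ → Set) : Set where
  field
    index       : ℕ → ℕ
    rank        : ℕ → ℕ
    rank≤       : ∀ j → rank j ≤ j
    index-valid : ∀ k → P (index k)
    rank-index  : ∀ k → rank (index k) ≡ k
    index-rank  : ∀ {j} → P j → index (rank j) ≡ j
    irrelevant  : ∀ {j} (p q : P j) → p ≡ q

module Reindex {P : ℕ → Set} (E : Enumeration P) {A : Set} (Q : A → Set) (m : A → ℕ)
               (N : ℕ) (bound : ∀ {a} → Q a → m a < N) where
  open Enumeration E

  Fibers : Set
  Fibers = Σ (Fin N) (λ k → Σ A (λ a → Q a × m a ≡ index (toℕ k)))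

  to : Σ A (λ a → Q a × P (m a)) → Fibers
  to (a , q , p) = fromℕ< rank<N , a , q , sym (trans (cong index (toℕ-fromℕ< rank<N)) (index-rank p))
    where
    rank<N : rank (m a) < N
    rank<N = ≤-<-trans (rank≤ (m a)) (bound q)

  from : Fibers → Σ A (λ a → Q a × P (m a))
  from (k , a , q , e) = a , q , subst P (sym e) (index-valid (toℕ k))

  same-index : ∀ {k k′ a q} {e : m a ≡ index (toℕ k)} {e′ : m a ≡ index (toℕ k′)} →
               k ≡ k′ → _≡_ {A = Fibers} (k , a , q , e) (k′ , a , q , e′)
  same-index {e = e} {e′} refl = cong (λ e″ → _ , _ , _ , e″) (≡-irrelevant e e′)

  to∘from : ∀ y → to (from y) ≡ y
  to∘from (k , a , q , e) = same-index (toℕ-injective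
    (trans (toℕ-fromℕ< _) (trans (cong rank e) (rank-index (toℕ k)))))

  reindex : Σ A (λ a → Q a × P (m a)) ↔ Fibers
  reindex = mk↔ₛ′ to from to∘from (λ { (a , q , p) → cong (λ p′ → a , q , p′) (irrelevant _ _) })

countByTailLength : {P : ℕ → Set} (E : Enumeration P) (n : ℕ) →
  let open Enumeration E in
  Σ DistinctPartition (λ π → Γ π ≡ n × P (length (rest π)))
    ↔ Fin (sumTo n (λ k → chainCount (n ∸ index k) (index k)))
countByTailLength E n =
  ↔-trans (Reindex.reindex E (λ π → Γ π ≡ n) (λ π → length (rest π)) (suc n) (λ {π} → tail<suc-n π))
  (↔-trans (Σ-↔ ↔-refl (λ {k} → fiber↔ (index (toℕ k))))
  (↔Fin-cast (cong sum (sym (map-applyUpTo (λ x → x) count (suc n))))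
             (Σ-Fin-sum (suc n) count)))
  where
  open Enumeration E
  count : ℕ → ℕ
  count k = chainCount (n ∸ index k) (index k)
  tail<suc-n : ∀ π → Γ π ≡ n → length (rest π) < suc n
  tail<suc-n π eΓ = s≤s (subst (length (rest π) ≤_) eΓ (tail≤Γ π))
  fiber↔ : ∀ j → Tail.Fiber n j ↔ Fin (chainCount (n ∸ j) j)
  fiber↔ j = ↔-trans (Tail.tail↔ n j) (chain↔ (n ∸ j) j)

-- 2 * suc k normalises to suc (k + suc (k + 0)); this moves the inner suc
-- outwards, exposing 2 * suc k = suc (suc (2 * k)).
double-suc : ∀ k → k + suc (k + 0) ≡ suc (k + (k + 0))
double-suc k = +-suc k (k + 0)

⌊2k+1/2⌋≡k : ∀ k → ⌊ 2 * k + 1 /2⌋ ≡ k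
⌊2k+1/2⌋≡k zero = refl
⌊2k+1/2⌋≡k (suc k) rewrite double-suc k = cong suc (⌊2k+1/2⌋≡k k)

⌊2k/2⌋≡k : ∀ k → ⌊ 2 * k /2⌋ ≡ k
⌊2k/2⌋≡k zero = refl
⌊2k/2⌋≡k (suc k) rewrite double-suc k = cong suc (⌊2k/2⌋≡k k)

even-2k+2 : ∀ k → Even (suc (2 * k + 1))
even-2k+2 zero = refl
even-2k+2 (suc k) rewrite double-suc k = even-2k+2 k

odd-2k+1 : ∀ k → Odd (suc (2 * k))
odd-2k+1 zero = refl
odd-2k+1 (suc k) rewrite double-suc k = odd-2k+1 k

odd-tail : ∀ {j} → Even (suc j) → 2 * ⌊ j /2⌋ + 1 ≡ j
odd-tail {suc zero}          _ = refl
odd-tail {suc (suc j)}       e rewrite double-suc ⌊ j /2⌋ = cong (λ x → suc (suc x)) (odd-tail {j} e)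

even-tail : ∀ {j} → Odd (suc j) → 2 * ⌊ j /2⌋ ≡ j
even-tail {zero}             _ = refl
even-tail {suc (suc j)}      o rewrite double-suc ⌊ j /2⌋ = cong (λ x → suc (suc x)) (even-tail {j} o)

oddTails : Enumeration (λ j → Even (suc j))
oddTails = record
  { index = λ k → 2 * k + 1 ; rank = ⌊_/2⌋ ; rank≤ = ⌊n/2⌋≤n
  ; index-valid = even-2k+2 ; rank-index = ⌊2k+1/2⌋≡k ; index-rank = odd-tail
  ; irrelevant = ≡-irrelevant }

evenTails : Enumeration (λ j → Odd (suc j))
evenTails = record
  { index = λ k → 2 * k ; rank = ⌊_/2⌋ ; rank≤ = ⌊n/2⌋≤n
  ; index-valid = odd-2k+1 ; rank-index = ⌊2k/2⌋≡k ; index-rank = even-tail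
  ; irrelevant = ≡-irrelevant }

hDE≡chains : ∀ n → hDE-formula n ≡ sumTo n (λ k → chainCount (n ∸ (2 * k + 1)) (2 * k + 1))
hDE≡chains n = cong sum (map-cong (λ k →
  trans (cong (λ b → binom (+ n - + b) (2 * k + 1)) (+-suc (2 * k) 1))
        (binom≡chainCount n (2 * k + 1) (2 * k + 1))) (upTo (suc n)))

hDO≡chains : ∀ n → hDO-formula n ≡ sumTo n (λ k → chainCount (n ∸ 2 * k) (2 * k))
hDO≡chains n = cong sum (map-cong (λ k →
  trans (cong (λ b → binom (+ n - + b) (2 * k)) (+-comm (2 * k) 1))
        (binom≡chainCount n (2 * k) (2 * k))) (upTo (suc n)))

-- The theorem: the number of parts is the tail length plus one, so an even
-- (odd) number of parts means an odd (even) tail length.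
proposition3p2 : (n : ℕ) → n ≥ 1 →
    (Σ DistinctPartition (λ π → (Γ π ≡ n) × Even (len π)) ↔ Fin (hDE-formula n))
    × (Σ DistinctPartition (λ π → (Γ π ≡ n) × Odd (len π)) ↔ Fin (hDO-formula n))
proposition3p2 n _ =
  ↔Fin-cast (sym (hDE≡chains n)) (countByTailLength oddTails n) ,
  ↔Fin-cast (sym (hDO≡chains n)) (countByTailLength evenTails n)
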